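{- Let $m$ be a positive integer and let $\Gamma$ be a subgroup of the symmetric group $\mathcal{S}_m$ acting transitively on $\{1,2,\dots,m\}$. Then for every non-empty finite simplicial complex $\Sigma$, the action of $\Gamma$ on ${\tt Ram}(\partial\Delta_m,\Sigma)$ given on vertices by $(\gamma,\eta)\mapsto\eta\gamma$ (and extended to cells) has no fixed points, i.e. no point of ${\tt Ram}(\partial\Delta_m,\Sigma)$ is fixed by every element of $\Gamma$.
   Context: $\partial\Delta_m$ is the simplicial complex on vertex set $\{1,\dots,m\}$ whose faces are all proper subsets of $\{1,\dots,m\}$. For a simplicial complex $\Sigma$, $\Sigma^0$ is its vertex set. For a finite set $V$, $\Delta_V$ is the simplex on $V$. The vertices of $\prod_{i\in I}\Delta_V$ are functions $\eta:I\to V$ and its cells are functions $\nu:I\to 2^V\setminus\{\emptyset\}$; a cell $\nu$ belongs to the induced subcomplex on a vertex set $E$ if every $\eta$ with $\eta(i)\in\nu(i)$ for all $i$ lies in $E$. For finite simplicial complexes $\Sigma_1,\Sigma_2$, ${\tt Ram}(\Sigma_1,\Sigma_2)$ is the induced subcomplex of $\prod_{v\in\Sigma_1^0}\Delta_{\Sigma_2^0}$ on the vertex set $\{\eta:\Sigma_1^0\to\Sigma_2^0\mid \eta^{ -1}(\sigma)\in\Sigma_1\text{ for all faces }\sigma\in\Sigma_2\}$. On cells, $\gamma$ sends $\nu$ to $i\mapsto\nu(\gamma(i))$; this induces an action on the geometric realization.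
   Formalization: Points of the geometric realization of ${\tt Ram}(\partial\Delta_m,\Sigma)$ have their barycentric coordinates taken in the rationals. -}

module Defs where

open import Level using (0ℓ) renaming (suc to lsuc)
open import Data.Nat using (ℕ; zero; suc)
open import Data.Fin using (Fin; zero; suc)
open import Data.Fin.Subset using (Subset; _∈_; _⊆_; ⁅_⁆)
open import Data.Fin.Permutation using (Permutation′; _⟨$⟩ʳ_; _≈_; id; flip; _∘ₚ_)
open import Data.Rational using (ℚ; 0ℚ; 1ℚ; _+_; _≤_; _<_)
open import Data.Product using (Σ; _×_; ∃)
open import Relation.Binary.PropositionalEquality using (_≡_)
open import Relation.Nullary using (¬_)

record SimplicialComplex (n : ℕ) : Set₁ where
  field
    IsFace      : Subset n → Set
    vertexFace  : ∀ v → IsFace ⁅ v ⁆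
    downClosed  : ∀ {σ τ} → τ ⊆ σ → IsFace σ → IsFace τ
open SimplicialComplex public

record IsSubgroup {m : ℕ} (Γ : Permutation′ m → Set) : Set where
  field
    respects : ∀ {γ δ} → γ ≈ δ → Γ γ → Γ δ
    hasId    : Γ id
    closed∘  : ∀ {γ δ} → Γ γ → Γ δ → Γ (γ ∘ₚ δ)
    closedInv : ∀ {γ} → Γ γ → Γ (flip γ)

Transitive : {m : ℕ} → (Permutation′ m → Set) → Set
Transitive {m} Γ = ∀ (i j : Fin m) → Σ (Permutation′ m) λ γ → Γ γ × (γ ⟨$⟩ʳ i ≡ j)

-- Faces of ∂Δ_m: proper subsets of Fin m, described by membership predicate.
-- η⁻¹(σ) is a face of ∂Δ_m iff it is not all of Fin m.
-- Vertex condition of Ram(∂Δ_m, Σ): η⁻¹(σ) ∈ ∂Δ_m for all faces σ of Σ.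
IsRamVertex : {m n : ℕ} → SimplicialComplex n → (Fin m → Fin n) → Set
IsRamVertex {m} S η = ∀ (σ : Subset _) → IsFace S σ → ¬ (∀ (i : Fin m) → η i ∈ σ)

sumℚ : {n : ℕ} → (Fin n → ℚ) → ℚ
sumℚ {zero}  f = 0ℚ
sumℚ {suc n} f = f zero + sumℚ (λ j → f (suc j))

-- A point of the geometric realization of ∏_{i ∈ Fin m} Δ_{Fin n}
-- (with rational barycentric coordinates): p i is a point of the simplex Δ_{Fin n}.
IsProductPoint : {m n : ℕ} → (Fin m → Fin n → ℚ) → Set
IsProductPoint p = (∀ i j → 0ℚ ≤ p i j) × (∀ i → sumℚ (p i) ≡ 1ℚ)

-- The point p lies in |Ram(∂Δ_m, Σ)|: its carrier cell ν (ν(i) = support of p i)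
-- belongs to the induced subcomplex, i.e. every η with η(i) ∈ ν(i) for all i
-- is a vertex of Ram(∂Δ_m, Σ).
InRam : {m n : ℕ} → SimplicialComplex n → (Fin m → Fin n → ℚ) → Set
InRam S p = IsProductPoint p × (∀ η → (∀ i → 0ℚ < p i (η i)) → IsRamVertex S η)

-- Action of γ on points, induced by η ↦ η ∘ γ: (γ · p)(i) = p(γ(i)).
act : {m n : ℕ} → Permutation′ m → (Fin m → Fin n → ℚ) → (Fin m → Fin n → ℚ)
act γ p i = p (γ ⟨$⟩ʳ i)

FixedBy : {m n : ℕ} → Permutation′ m → (Fin m → Fin n → ℚ) → Set
FixedBy γ p = ∀ i j → act γ p i j ≡ p i j

{-# OPTIONS --safe #-}
module Submission where

-- A point fixed by a transitive group has all its coordinates p i equal.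
-- Pick j in the support of one of them; then the constant map i ↦ j lies in
-- the carrier cell of p, but it pulls the face {j} back to all of
-- {1,…,m}, which is not a face of ∂Δ_m.

open import Defs
open import Data.Nat using (ℕ; suc; zero)
open import Data.Fin using (Fin; zero; suc)
open import Data.Fin.Permutation using (Permutation′)
open import Data.Fin.Subset using (⁅_⁆)
open import Data.Fin.Subset.Properties using (x∈⁅x⁆)
open import Data.Rational using (ℚ; 0ℚ; 1ℚ; _+_; _≤_; _<_)
open import Data.Rational.Properties using (≤-antisym; ≮⇒≥; _<?_; +-identityˡ)
open import Data.Product using (Σ; ∃; _×_; _,_)
open import Relation.Nullary using (¬_; yes; no)
open import Relation.Binary.PropositionalEquality using (_≡_; refl; sym; trans; cong; subst)

sumℚ≢0⇒∃-positive : ∀ {k} (f : Fin k → ℚ) → (∀ j → 0ℚ ≤ f j) → ¬ sumℚ f ≡ 0ℚ →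
                     ∃ λ j → 0ℚ < f j
sumℚ≢0⇒∃-positive {zero}  f nonneg sum≢0 with () ← sum≢0 refl
sumℚ≢0⇒∃-positive {suc k} f nonneg sum≢0 with 0ℚ <? f zero
... | yes f0>0 = zero , f0>0
... | no  f0≯0 with sumℚ≢0⇒∃-positive (λ j → f (suc j)) (λ j → nonneg (suc j)) tail-sum≢0
  where
  f0≡0 : f zero ≡ 0ℚ
  f0≡0 = ≤-antisym (≮⇒≥ f0≯0) (nonneg zero)

  tail-sum≢0 : ¬ sumℚ (λ j → f (suc j)) ≡ 0ℚ
  tail-sum≢0 eq = sum≢0 (trans (cong (_+ sumℚ (λ j → f (suc j))) f0≡0)
                               (trans (+-identityˡ _) eq))
... | j , fj>0 = suc j , fj>0

probability-support-nonempty : ∀ {k} (q : Fin k → ℚ) → (∀ j → 0ℚ ≤ q j) → sumℚ q ≡ 1ℚ →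
                               ∃ λ j → 0ℚ < q j
probability-support-nonempty q nonneg sum≡1 =
  sumℚ≢0⇒∃-positive q nonneg (λ sum≡0 → 1≢0 (trans (sym sum≡1) sum≡0))
  where
  1≢0 : ¬ 1ℚ ≡ 0ℚ
  1≢0 ()

fixed-by-transitive⇒rows-equal : ∀ {m n} {Γ : Permutation′ m → Set} {p : Fin m → Fin n → ℚ} →
                                  Transitive Γ → (∀ γ → Γ γ → FixedBy γ p) →
                                  ∀ i i′ j → p i′ j ≡ p i j
fixed-by-transitive⇒rows-equal {p = p} transitive fixed i i′ j
  with γ , γ∈Γ , γi≡i′ ← transitive i i′ =
  trans (cong (λ x → p x j) (sym γi≡i′)) (fixed γ γ∈Γ i j)

constant-¬RamVertex : ∀ {m n} (S : SimplicialComplex n) (j : Fin n) →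
                      ¬ IsRamVertex {m} S (λ _ → j)
constant-¬RamVertex S j isVertex = isVertex ⁅ j ⁆ (vertexFace S j) (λ _ → x∈⁅x⁆ j)

proposition5 : (m : ℕ) → (Γ : Permutation′ (suc m) → Set) → IsSubgroup Γ → Transitive Γ →
    (n : ℕ) → (S : SimplicialComplex (suc n)) →
    ¬ (Σ (Fin (suc m) → Fin (suc n) → ℚ) λ p → InRam S p × (∀ γ → Γ γ → FixedBy γ p))
proposition5 m Γ _ transitive n S (p , ((nonneg , sum≡1) , carrier⊆Ram) , fixed)
  with j , p0j>0 ← probability-support-nonempty (p zero) (nonneg zero) (sum≡1 zero) =
  constant-¬RamVertex S j (carrier⊆Ram (λ _ → j) constant-in-carrier)
  where
  constant-in-carrier : ∀ i → 0ℚ < p i j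
  constant-in-carrier i =
    subst (0ℚ <_) (sym (fixed-by-transitive⇒rows-equal transitive fixed zero i j)) p0j>0
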